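{- Let $f:\mathbb{N}\to\{ -1,0,1\}$ be multiplicative, supported on the squarefree integers ($f=\mu^2 f$), with $f(p)\in\{ -1,1\}$ for every prime $p$, and suppose $\mathbb{D}(f,\chi)<\infty$ for some real, non-principal, primitive Dirichlet character $\chi$ of conductor $q$. Let $F$, $h$ and $M_p(F,\overline{F},d)$ be as in the context. Let $p\nmid q$ be prime, $d\in\mathbb{N}$ and $p^n\|d$ with $n\ge 0$. Then $$M_p(F,\overline{F},d)=\begin{cases}h(p),&n=0,\\ 1-\frac{2}{p^2},&n=1,\\ 1-\frac{1}{p^2},&n\ge 2.\end{cases}$$
   Context: $\mathbb{D}(f,\chi)=\left(\sum_{p}\frac{1-\mathrm{Re}(f(p)\overline{\chi(p)})}{p}\right)^{1/2}$ over all primes. $F$ is the multiplicative function with $F(p^k)=f(p^k)\chi(p^k)$ if $p\nmid q$ and $F(p^k)=1$ if $p\mid q$. For $p\nmid q$, $h(p)=1-\frac{2(1-F(p))}{p}-\frac{2F(p)}{p^2}$. For a prime $p\nmid q$, $F_p$ is the multiplicative function with $F_p(p^k)=F(p^k)$ and $F_p(\tilde p^k)=1$ for primes $\tilde p\neq p$; $M_p(F,\overline{F},d)=\lim_{x\to\infty}\frac1x\sum_{n\le x}F_p(n)\overline{F_p(n+d)}$. $p^n\|d$ means $p^n\mid d$, $p^{n+1}\nmid d$. -}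

module Defs where

open import Data.Nat as ℕ using (ℕ; zero; suc; _≤_; _<_)
open import Data.Nat.Divisibility using (_∣_; _∣?_; divides)
open import Data.Nat.Coprimality using (Coprime)
open import Data.Nat.Primality using (Prime; prime?)
open import Data.Integer as ℤ using (ℤ; +_)
open import Data.Rational as ℚ using (ℚ; 0ℚ; 1ℚ; _/_)
open import Data.Product using (_×_; ∃; Σ)
open import Data.Sum using (_⊎_)
open import Relation.Nullary using (¬_; yes; no)
open import Relation.Binary.PropositionalEquality using (_≡_; _≢_)

toℚ : ℤ → ℚ
toℚ z = z / 1

-- 1/n as a rational (junk value 0 at n = 0; only used for n ≥ 1)
inv : ℕ → ℚ
inv zero    = 0ℚ
inv (suc k) = + 1 / suc k

sumTo : (ℕ → ℚ) → ℕ → ℚ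
sumTo a zero    = 0ℚ
sumTo a (suc N) = sumTo a N ℚ.+ a (suc N)

ConvergesTo : (ℕ → ℚ) → ℚ → Set
ConvergesTo a L = ∀ (ε : ℚ) → 0ℚ ℚ.< ε →
  ∃ λ N → ∀ x → N ≤ x → ℚ.∣ a x ℚ.- L ∣ ℚ.< ε

Cong : ℕ → ℕ → ℕ → Set
Cong d m n = ∃ λ a → ∃ λ b → m ℕ.+ a ℕ.* d ≡ n ℕ.+ b ℕ.* d

SquareFree : ℕ → Set
SquareFree n = ∀ p → Prime p → ¬ (p ℕ.* p ∣ n)

Multiplicative : (ℕ → ℤ) → Set
Multiplicative f = f 1 ≡ + 1 ×
  (∀ m n → 1 ≤ m → 1 ≤ n → Coprime m n → f (m ℕ.* n) ≡ f m ℤ.* f n)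

-- a real (ℤ-valued) Dirichlet character modulo q
IsDirichletChar : ℕ → (ℕ → ℤ) → Set
IsDirichletChar q χ = 1 ≤ q × χ 1 ≡ + 1 ×
  (∀ m n → χ (m ℕ.* n) ≡ χ m ℤ.* χ n) ×
  (∀ n → χ (n ℕ.+ q) ≡ χ n) ×
  (∀ n → Coprime n q → χ n ≢ + 0) ×
  (∀ n → ¬ Coprime n q → χ n ≡ + 0)

NonPrincipal : ℕ → (ℕ → ℤ) → Set
NonPrincipal q χ = ∃ λ n → Coprime n q × χ n ≢ + 1

InducedModulus : ℕ → (ℕ → ℤ) → ℕ → Set
InducedModulus q χ d = ∀ n → Coprime n q → Cong d n 1 → χ n ≡ + 1

-- χ mod q is primitive (so its conductor is q): no proper divisor of q is an induced modulus
Primitive : ℕ → (ℕ → ℤ) → Set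
Primitive q χ = ∀ d → d ∣ q → d < q → ¬ InducedModulus q χ d

pretTerm : (ℕ → ℤ) → (ℕ → ℤ) → ℕ → ℚ
pretTerm f χ n with prime? n
... | yes _ = (1ℚ ℚ.- toℚ (f n ℤ.* χ n)) ℚ.* inv n
... | no  _ = 0ℚ

-- 𝔻(f,χ) < ∞ : the series of nonnegative terms Σ_p (1 - Re f(p)χ̄(p))/p has bounded partial sums
PretFinite : (ℕ → ℤ) → (ℕ → ℤ) → Set
PretFinite f χ = ∃ λ B → ∀ N → sumTo (pretTerm f χ) N ℚ.≤ B

-- p-adic valuation (with fuel); valuation p n = largest v with p^v ∣ n, for p ≥ 2, n ≥ 1
valFuel : ℕ → ℕ → ℕ → ℕ
valFuel zero    p n = 0
valFuel (suc k) p n with p ∣? n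
... | yes (divides m _) = suc (valFuel k p m)
... | no  _             = 0

valuation : ℕ → ℕ → ℕ
valuation p n = valFuel n p n

-- F(p^k) = f(p^k) χ(p^k)  (for p ∤ q)
Fpk : (ℕ → ℤ) → (ℕ → ℤ) → ℕ → ℕ → ℤ
Fpk f χ p k = f (p ℕ.^ k) ℤ.* χ (p ℕ.^ k)

Fp : (ℕ → ℤ) → (ℕ → ℤ) → ℕ → ℕ → ℤ
Fp f χ p n = Fpk f χ p (valuation p n)

-- (1/x) Σ_{n ≤ x} F_p(n) conj(F_p(n+d))   (F_p is real-valued)
Mavg : (ℕ → ℤ) → (ℕ → ℤ) → ℕ → ℕ → ℕ → ℚ
Mavg f χ p d x = sumTo (λ n → toℚ (Fp f χ p n ℤ.* Fp f χ p (n ℕ.+ d))) x ℚ.* inv x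

hval : (ℕ → ℤ) → (ℕ → ℤ) → ℕ → ℚ
hval f χ p = (1ℚ ℚ.- (toℚ (+ 2) ℚ.* (1ℚ ℚ.- Fp1) ℚ.* inv p))
              ℚ.- (toℚ (+ 2) ℚ.* Fp1 ℚ.* inv (p ℕ.* p))
  where Fp1 = toℚ (Fpk f χ p 1)

module Submission where

-- Since f vanishes off the squarefree numbers, F_p(n) depends only on how often
-- p divides n: it is 1, e or 0 according as p ∤ n, p ∥ n or p² ∣ n, where
-- e = F(p) = f(p)χ(p).  Writing this local factor through the indicators of
-- p ∣ n and p² ∣ n, the lagged product F_p(n) F_p(n + d) becomes, in each of the
-- cases p ∤ d, p ∥ d and p² ∣ d, a fixed linear combination of the constant 1
-- and of indicators of p ∣ n + c and p² ∣ n + c (the last two cases use e² = 1).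
-- Multiples of m in a shifted interval have density 1/m with error at most 1/x,
-- and mean values with O(1/x) error are linear and are limits of the averages;
-- this yields the three limits h(p), 1 - 2/p² and 1 - 1/p².  Finally e² = 1:
-- f(p) = ±1 by hypothesis, and χ(p) = ±1 since χ(p) ≠ 0 and a periodic (hence
-- bounded) completely multiplicative integer-valued function only takes the
-- values 0 and ±1.

module MeanValues where

  open import Defs
  open import Data.Nat as ℕ using (ℕ; zero; suc; z≤n; s≤s; NonZero)
  import Data.Nat.Properties as ℕP
  open import Data.Integer as ℤ using (ℤ; +_; -[1+_]; +[1+_])
  import Data.Integer.Properties as ℤP
  open import Data.Rational as ℚ using (ℚ; mkℚ; 0ℚ; 1ℚ; _+_; _*_; _-_; -_; _≤_; _<_; ∣_∣; 1/_)
  open import Data.Rational.Literals using (fromℤ)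
  import Data.Rational.Properties as ℚP
  import Data.Rational.Unnormalised as ℚᵘ
  import Data.Rational.Unnormalised.Properties as ℚᵘP
  open import Data.Rational.Solver using (module +-*-Solver)
  open import Data.Product using (∃; _×_; _,_)
  open import Data.Sum using (_⊎_; inj₁; inj₂)
  open import Data.Empty using (⊥-elim)
  open import Relation.Nullary using (¬_; Dec; yes; no)
  open import Data.Nat.Divisibility using (_∣_; _∣?_; n∣m⇒m%n≡0; m%n≡0⇒n∣m)
  open import Data.Nat.DivMod using (_%_; _/_; m%n<n; m≡m%n+[m/n]*n; [m+kn]%n≡m%n; m<n⇒m%n≡m; n%n≡0)
  open import Data.Nat.Coprimality using (Coprime)
  open import Relation.Binary.PropositionalEquality

  -- toℚ agrees with the literal embedding fromℤ, whose normal form is evident;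
  -- through it toℚ is a ring homomorphism.
  toℚ≡fromℤ : ∀ z → toℚ z ≡ fromℤ z
  toℚ≡fromℤ z = ℚP.↥p/↧p≡p (fromℤ z)

  toℚ-+ : ∀ a b → toℚ (a ℤ.+ b) ≡ toℚ a + toℚ b
  toℚ-+ a b rewrite toℚ≡fromℤ a | toℚ≡fromℤ b =
    cong (ℚ._/ 1) (cong₂ ℤ._+_ (sym (ℤP.*-identityʳ a)) (sym (ℤP.*-identityʳ b)))

  toℚ-* : ∀ a b → toℚ (a ℤ.* b) ≡ toℚ a * toℚ b
  toℚ-* a b rewrite toℚ≡fromℤ a | toℚ≡fromℤ b = refl

  inv-cancel : ∀ m .{{_ : NonZero m}} → toℚ (+ m) * inv m ≡ 1ℚ
  inv-cancel (suc k) rewrite toℚ≡fromℤ (+ suc k) | ℚP.↥p/↧p≡p (1/ (fromℤ (+ suc k))) =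
    ℚP.*-inverseʳ (fromℤ (+ suc k))

  0≤inv : ∀ x → 0ℚ ≤ inv x
  0≤inv zero = ℚP.≤-refl
  0≤inv (suc k) rewrite ℚP.↥p/↧p≡p (1/ (fromℤ (+ suc k))) = ℚ.*≤* (ℤ.+≤+ z≤n)

  archimedean : ∀ K → ∃ λ k → K ≤ toℚ (+ k)
  archimedean K@(mkℚ num den-1 _) = ℤ.∣ num ∣ , subst (K ≤_) (sym (toℚ≡fromℤ (+ ℤ.∣ num ∣))) (ℚ.*≤* (num≤ num))
    where
    num≤ : ∀ n → n ℤ.* + 1 ℤ.≤ + ℤ.∣ n ∣ ℤ.* + suc den-1
    num≤ (+ k) rewrite ℤP.*-identityʳ (+ k) | sym (ℤP.pos-* k (suc den-1)) = ℤ.+≤+ (ℕP.m≤m*n k (suc den-1))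
    num≤ -[1+ k ] = ℤ.-≤+

  avg : (ℕ → ℚ) → ℕ → ℚ
  avg u x = sumTo u x * inv x

  record Mean (u : ℕ → ℚ) (L : ℚ) : Set where
    constructor mkMean
    field
      K     : ℚ
      error : ∀ x → 1 ℕ.≤ x → ∣ avg u x - L ∣ ≤ K * inv x
  open Mean

  mean-ext : ∀ {u v L} → (∀ n → 1 ℕ.≤ n → u n ≡ v n) → Mean u L → Mean v L
  mean-ext {u} {v} {L} u≡v mean = mkMean (K mean) λ x x≥1 →
    subst (λ s → ∣ s * inv x - L ∣ ≤ K mean * inv x) (sums x) (error mean x x≥1)
    where
    sums : ∀ x → sumTo u x ≡ sumTo v x
    sums zero    = refl
    sums (suc x) = cong₂ _+_ (sums x) (u≡v (suc x) (s≤s z≤n))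

  mean-one : Mean (λ _ → 1ℚ) 1ℚ
  mean-one = mkMean 0ℚ bound
    where
    open ≡-Reasoning
    ones : ∀ x → sumTo (λ _ → 1ℚ) x ≡ toℚ (+ x)
    ones zero    = refl
    ones (suc x) = begin
      sumTo (λ _ → 1ℚ) x + 1ℚ ≡⟨ cong (_+ 1ℚ) (ones x) ⟩
      toℚ (+ x) + toℚ (+ 1)   ≡⟨ sym (toℚ-+ (+ x) (+ 1)) ⟩
      toℚ (+ (x ℕ.+ 1))       ≡⟨ cong (λ k → toℚ (+ k)) (ℕP.+-comm x 1) ⟩
      toℚ (+ suc x)           ∎
    bound : ∀ x → 1 ℕ.≤ x → ∣ avg (λ _ → 1ℚ) x - 1ℚ ∣ ≤ 0ℚ * inv x
    bound (suc x) _ = ℚP.≤-reflexive (begin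
      ∣ sumTo (λ _ → 1ℚ) (suc x) * inv (suc x) - 1ℚ ∣ ≡⟨ cong (λ s → ∣ s * inv (suc x) - 1ℚ ∣) (ones (suc x)) ⟩
      ∣ toℚ (+ suc x) * inv (suc x) - 1ℚ ∣            ≡⟨ cong (λ t → ∣ t - 1ℚ ∣) (inv-cancel (suc x)) ⟩
      0ℚ                                              ≡⟨ sym (ℚP.*-zeroˡ (inv (suc x))) ⟩
      0ℚ * inv (suc x)                                ∎)

  mean-+ : ∀ {u v L₁ L₂} → Mean u L₁ → Mean v L₂ → Mean (λ n → u n + v n) (L₁ + L₂)
  mean-+ {u} {v} {L₁} {L₂} mean₁ mean₂ = mkMean (K₁ + K₂) λ x x≥1 → begin
    ∣ sumTo (λ n → u n + v n) x * inv x - (L₁ + L₂) ∣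
      ≡⟨ cong (λ s → ∣ s * inv x - (L₁ + L₂) ∣) (sums x) ⟩
    ∣ (sumTo u x + sumTo v x) * inv x - (L₁ + L₂) ∣
      ≡⟨ cong ∣_∣ (solve 5 (λ a b i l m → (a :+ b) :* i :- (l :+ m) := (a :* i :- l) :+ (b :* i :- m))
                     refl (sumTo u x) (sumTo v x) (inv x) L₁ L₂) ⟩
    ∣ (avg u x - L₁) + (avg v x - L₂) ∣
      ≤⟨ ℚP.∣p+q∣≤∣p∣+∣q∣ (avg u x - L₁) (avg v x - L₂) ⟩
    ∣ avg u x - L₁ ∣ + ∣ avg v x - L₂ ∣
      ≤⟨ ℚP.+-mono-≤ (error mean₁ x x≥1) (error mean₂ x x≥1) ⟩
    K₁ * inv x + K₂ * inv x
      ≡⟨ sym (ℚP.*-distribʳ-+ (inv x) K₁ K₂) ⟩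
    (K₁ + K₂) * inv x ∎
    where
    K₁ = K mean₁
    K₂ = K mean₂
    open ℚP.≤-Reasoning
    open +-*-Solver
    sums : ∀ x → sumTo (λ n → u n + v n) x ≡ sumTo u x + sumTo v x
    sums zero    = refl
    sums (suc x) rewrite sums x =
      solve 4 (λ a b c d → (a :+ b) :+ (c :+ d) := (a :+ c) :+ (b :+ d)) refl
        (sumTo u x) (sumTo v x) (u (suc x)) (v (suc x))

  mean-scale : ∀ c {u L} → Mean u L → Mean (λ n → c * u n) (c * L)
  mean-scale c {u} {L} mean = mkMean (∣ c ∣ * K mean) λ x x≥1 → begin
    ∣ sumTo (λ n → c * u n) x * inv x - c * L ∣
      ≡⟨ cong (λ s → ∣ s * inv x - c * L ∣) (sums x) ⟩
    ∣ c * sumTo u x * inv x - c * L ∣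
      ≡⟨ cong ∣_∣ (solve 4 (λ c s i l → c :* s :* i :- c :* l := c :* (s :* i :- l)) refl c (sumTo u x) (inv x) L) ⟩
    ∣ c * (avg u x - L) ∣
      ≡⟨ ℚP.∣p*q∣≡∣p∣*∣q∣ c (avg u x - L) ⟩
    ∣ c ∣ * ∣ avg u x - L ∣
      ≤⟨ ℚP.*-monoˡ-≤-nonNeg ∣ c ∣ {{ℚP.∣-∣-nonNeg c}} (error mean x x≥1) ⟩
    ∣ c ∣ * (K mean * inv x)
      ≡⟨ sym (ℚP.*-assoc ∣ c ∣ (K mean) (inv x)) ⟩
    ∣ c ∣ * K mean * inv x ∎
    where
    open ℚP.≤-Reasoning
    open +-*-Solver
    sums : ∀ x → sumTo (λ n → c * u n) x ≡ c * sumTo u x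
    sums zero    = sym (ℚP.*-zeroʳ c)
    sums (suc x) rewrite sums x = sym (ℚP.*-distribˡ-+ c (sumTo u x) (u (suc x)))

  mean-neg : ∀ {u L} → Mean u L → Mean (λ n → - u n) (- L)
  mean-neg {u} {L} mean = mkMean (K mean) λ x x≥1 → begin
    ∣ sumTo (λ n → - u n) x * inv x - - L ∣
      ≡⟨ cong (λ s → ∣ s * inv x - - L ∣) (sums x) ⟩
    ∣ - sumTo u x * inv x - - L ∣
      ≡⟨ cong ∣_∣ (solve 3 (λ s i l → :- s :* i :- :- l := :- (s :* i :- l)) refl (sumTo u x) (inv x) L) ⟩
    ∣ - (avg u x - L) ∣
      ≡⟨ ℚP.∣-p∣≡∣p∣ (avg u x - L) ⟩
    ∣ avg u x - L ∣
      ≤⟨ error mean x x≥1 ⟩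
    K mean * inv x ∎
    where
    open ℚP.≤-Reasoning
    open +-*-Solver
    sums : ∀ x → sumTo (λ n → - u n) x ≡ - sumTo u x
    sums zero    = refl
    sums (suc x) rewrite sums x = sym (ℚP.neg-distrib-+ (sumTo u x) (u (suc x)))

  mean-- : ∀ {u v L₁ L₂} → Mean u L₁ → Mean v L₂ → Mean (λ n → u n - v n) (L₁ - L₂)
  mean-- mean₁ mean₂ = mean-+ mean₁ (mean-neg mean₂)

  small-quotient : ∀ k a b .(c : Coprime (suc a) (suc b)) x → k ℕ.* suc b ℕ.< suc x →
                   toℚ (+ k) * inv (suc x) < mkℚ +[1+ a ] b c
  small-quotient k a b c x k[1+b]<1+x rewrite toℚ≡fromℤ (+ k) | ℚP.↥p/↧p≡p (1/ (fromℤ (+ suc x))) =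
    ℚP.toℚᵘ-cancel-< (ℚᵘP.<-respˡ-≃ (ℚᵘP.≃-sym (ℚP.toℚᵘ-homo-* (fromℤ (+ k)) (1/ fromℤ (+ suc x))))
      (ℚᵘ.*<* cross))
    where
    cross : (+ k ℤ.* + 1) ℤ.* + suc b ℤ.< +[1+ a ] ℤ.* + suc (x ℕ.+ 0)
    cross rewrite ℤP.*-identityʳ (+ k) | sym (ℤP.pos-* k (suc b))
                | sym (ℤP.pos-* (suc a) (suc (x ℕ.+ 0))) | ℕP.+-identityʳ x =
      ℤ.+<+ (ℕP.<-≤-trans k[1+b]<1+x (ℕP.m≤m+n (suc x) (a ℕ.* suc x)))

  mean⇒converges : ∀ {u L} → Mean u L → ConvergesTo (avg u) L
  mean⇒converges {u} {L} (mkMean K bound) ε ε>0 with archimedean K | ε | ε>0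
  ... | k , K≤k | mkℚ (+ zero) _ _  | ℚ.*<* (ℤ.+<+ ())
  ... | k , K≤k | mkℚ -[1+ _ ] _ _  | ℚ.*<* ()
  ... | k , K≤k | mkℚ +[1+ a ] b c | _ = suc (k ℕ.* suc b) , tail
    where
    open ℚP.≤-Reasoning
    tail : ∀ x → suc (k ℕ.* suc b) ℕ.≤ x → ∣ avg u x - L ∣ < mkℚ +[1+ a ] b c
    tail (suc x) (s≤s N≤x) = begin-strict
      ∣ avg u (suc x) - L ∣    ≤⟨ bound (suc x) (s≤s z≤n) ⟩
      K * inv (suc x)          ≤⟨ ℚP.*-monoʳ-≤-nonNeg (inv (suc x)) {{ℚ.nonNegative (0≤inv (suc x))}} K≤k ⟩
      toℚ (+ k) * inv (suc x)  <⟨ small-quotient k a b c x (s≤s N≤x) ⟩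
      mkℚ +[1+ a ] b c         ∎

  𝟙 : ∀ {P : Set} → Dec P → ℕ
  𝟙 (yes _) = 1
  𝟙 (no _)  = 0

  𝟙∣ : ℕ → ℕ → ℚ
  𝟙∣ m n = toℚ (+ 𝟙 (m ∣? n))

  count : (m c x : ℕ) → ℕ
  count m c zero    = 0
  count m c (suc x) = count m c x ℕ.+ 𝟙 (m ∣? suc x ℕ.+ c)

  sum-indicator : ∀ m c x → sumTo (λ n → 𝟙∣ m (n ℕ.+ c)) x ≡ toℚ (+ count m c x)
  sum-indicator m c zero    = refl
  sum-indicator m c (suc x) rewrite sum-indicator m c x =
    sym (toℚ-+ (+ count m c x) (+ 𝟙 (m ∣? suc x ℕ.+ c)))

  %-suc : ∀ y m .{{_ : NonZero m}} → suc y % m ≡ suc (y % m) % m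
  %-suc y m = begin
    suc y % m                             ≡⟨ cong (λ t → suc t % m) (m≡m%n+[m/n]*n y m) ⟩
    (suc (y % m) ℕ.+ (y / m) ℕ.* m) % m   ≡⟨ [m+kn]%n≡m%n (suc (y % m)) (y / m) m ⟩
    suc (y % m) % m                       ∎
    where open ≡-Reasoning

  remainder-step : ∀ m y .{{_ : NonZero m}} →
    (m ∣ suc y × suc (y % m) ≡ m) ⊎ (¬ m ∣ suc y × suc y % m ≡ suc (y % m))
  remainder-step m y with ℕP.m≤n⇒m<n∨m≡n (m%n<n y m)
  ... | inj₁ 1+r<m = inj₂ (1+y∤ , increases)
    where
    increases : suc y % m ≡ suc (y % m)
    increases = trans (%-suc y m) (m<n⇒m%n≡m 1+r<m)
    1+y∤ : ¬ m ∣ suc y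
    1+y∤ m∣1+y = ℕP.0≢1+n (trans (sym (n∣m⇒m%n≡0 (suc y) m m∣1+y)) increases)
  ... | inj₂ 1+r≡m = inj₁ (m%n≡0⇒n∣m (suc y) m wraps , 1+r≡m)
    where
    wraps : suc y % m ≡ 0
    wraps = trans (%-suc y m) (trans (cong (_% m) 1+r≡m) (n%n≡0 m))

  -- One step of counting: the count grows by 1 exactly when the remainder wraps around.
  count-step : ∀ m y k .{{_ : NonZero m}} →
    m ℕ.* (k ℕ.+ 𝟙 (m ∣? suc y)) ℕ.+ suc y % m ≡ m ℕ.* k ℕ.+ suc (y % m)
  count-step m y k with m ∣? suc y | remainder-step m y
  ... | yes m∣ | inj₁ (_ , 1+r≡m) = begin
    m ℕ.* (k ℕ.+ 1) ℕ.+ suc y % m   ≡⟨ cong₂ ℕ._+_ (ℕP.*-distribˡ-+ m k 1) (n∣m⇒m%n≡0 _ m m∣) ⟩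
    m ℕ.* k ℕ.+ m ℕ.* 1 ℕ.+ 0       ≡⟨ ℕP.+-identityʳ _ ⟩
    m ℕ.* k ℕ.+ m ℕ.* 1             ≡⟨ cong (m ℕ.* k ℕ.+_) (trans (ℕP.*-identityʳ m) (sym 1+r≡m)) ⟩
    m ℕ.* k ℕ.+ suc (y % m)         ∎
    where open ≡-Reasoning
  ... | yes m∣ | inj₂ (m∤ , _) = ⊥-elim (m∤ m∣)
  ... | no m∤  | inj₁ (m∣ , _) = ⊥-elim (m∤ m∣)
  ... | no _   | inj₂ (_ , increases) =
    cong₂ ℕ._+_ (cong (m ℕ.*_) (ℕP.+-identityʳ k)) increases

  count-invariant : ∀ m c x .{{_ : NonZero m}} →
    m ℕ.* count m c x ℕ.+ (x ℕ.+ c) % m ≡ x ℕ.+ c % m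
  count-invariant m c zero    = cong (ℕ._+ c % m) (ℕP.*-zeroʳ m)
  count-invariant m c (suc x) = begin
    m ℕ.* count m c (suc x) ℕ.+ suc (x ℕ.+ c) % m  ≡⟨ count-step m (x ℕ.+ c) (count m c x) ⟩
    m ℕ.* count m c x ℕ.+ suc ((x ℕ.+ c) % m)      ≡⟨ ℕP.+-suc _ _ ⟩
    suc (m ℕ.* count m c x ℕ.+ (x ℕ.+ c) % m)      ≡⟨ cong suc (count-invariant m c x) ⟩
    suc x ℕ.+ c % m                                ∎
    where open ≡-Reasoning

  toℚ-mono : ∀ {A B} → A ℕ.≤ B → toℚ (+ A) ≤ toℚ (+ B)
  toℚ-mono {A} {B} A≤B rewrite toℚ≡fromℤ (+ A) | toℚ≡fromℤ (+ B) =
    ℚ.*≤* (subst₂ ℤ._≤_ (sym (ℤP.*-identityʳ (+ A))) (sym (ℤP.*-identityʳ (+ B))) (ℤ.+≤+ A≤B))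

  difference≤ : ∀ A B m → A ℕ.≤ B ℕ.+ m → toℚ (+ A) - toℚ (+ B) ≤ toℚ (+ m)
  difference≤ A B m A≤B+m = begin
    toℚ (+ A) - toℚ (+ B)              ≤⟨ ℚP.+-monoˡ-≤ (- toℚ (+ B)) (toℚ-mono A≤B+m) ⟩
    toℚ (+ (B ℕ.+ m)) - toℚ (+ B)      ≡⟨ cong (_- toℚ (+ B)) (toℚ-+ (+ B) (+ m)) ⟩
    toℚ (+ B) + toℚ (+ m) - toℚ (+ B)  ≡⟨ solve 2 (λ b k → b :+ k :- b := k) refl (toℚ (+ B)) (toℚ (+ m)) ⟩
    toℚ (+ m)                          ∎
    where
    open ℚP.≤-Reasoning
    open +-*-Solver

  nat-distance : ∀ A B m → A ℕ.≤ B ℕ.+ m → B ℕ.≤ A ℕ.+ m → ∣ toℚ (+ A) - toℚ (+ B) ∣ ≤ toℚ (+ m)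
  nat-distance A B m A≤B+m B≤A+m with ℚP.∣p∣≡p∨∣p∣≡-p (toℚ (+ A) - toℚ (+ B))
  ... | inj₁ ∣t∣≡t  rewrite ∣t∣≡t  = difference≤ A B m A≤B+m
  ... | inj₂ ∣t∣≡-t rewrite ∣t∣≡-t =
    subst (_≤ toℚ (+ m)) (solve 2 (λ a b → b :- a := :- (a :- b)) refl (toℚ (+ A)) (toℚ (+ B)))
          (difference≤ B A m B≤A+m)
    where open +-*-Solver

  count-close : ∀ m c x .{{_ : NonZero m}} →
    ∣ toℚ (+ (m ℕ.* count m c x)) - toℚ (+ x) ∣ ≤ toℚ (+ m)
  count-close m c x = nat-distance (m ℕ.* count m c x) x m mC≤x+m x≤mC+m
    where
    invariant = count-invariant m c x
    mC≤x+m : m ℕ.* count m c x ℕ.≤ x ℕ.+ m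
    mC≤x+m = ℕP.≤-trans (ℕP.m≤m+n _ ((x ℕ.+ c) % m))
      (subst (ℕ._≤ x ℕ.+ m) (sym invariant) (ℕP.+-monoʳ-≤ x (ℕP.<⇒≤ (m%n<n c m))))
    x≤mC+m : x ℕ.≤ m ℕ.* count m c x ℕ.+ m
    x≤mC+m = ℕP.≤-trans (ℕP.m≤m+n x (c % m))
      (subst (ℕ._≤ m ℕ.* count m c x ℕ.+ m) invariant (ℕP.+-monoʳ-≤ (m ℕ.* count m c x) (ℕP.<⇒≤ (m%n<n (x ℕ.+ c) m))))

  quotient-difference : ∀ C m x .{{_ : NonZero m}} .{{_ : NonZero x}} →
    C * inv x - inv m ≡ (toℚ (+ m) * C - toℚ (+ x)) * (inv m * inv x)
  quotient-difference C m x = begin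
    C * inv x - inv m                              ≡⟨ solve 3 (λ c i j → c :* i :- j := c :* i :* con 1ℚ :- j :* con 1ℚ) refl C (inv x) (inv m) ⟩
    C * inv x * 1ℚ - inv m * 1ℚ                    ≡⟨ cong₂ (λ s t → C * inv x * s - inv m * t) (sym (inv-cancel m)) (sym (inv-cancel x)) ⟩
    C * inv x * (M * inv m) - inv m * (X * inv x)  ≡⟨ solve 5 (λ c i j k y → c :* i :* (k :* j) :- j :* (y :* i) := (k :* c :- y) :* (j :* i)) refl C (inv x) (inv m) M X ⟩
    (M * C - X) * (inv m * inv x)                  ∎
    where
    open ≡-Reasoning
    open +-*-Solver
    M = toℚ (+ m)
    X = toℚ (+ x)

  0≤inv*inv : ∀ m x → 0ℚ ≤ inv m * inv x
  0≤inv*inv m x = ℚP.nonNegative⁻¹ _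
    {{ℚP.nonNeg*nonNeg⇒nonNeg (inv m) {{ℚ.nonNegative (0≤inv m)}} (inv x) {{ℚ.nonNegative (0≤inv x)}}}}

  mean-multiples : ∀ m c .{{_ : NonZero m}} → Mean (λ n → 𝟙∣ m (n ℕ.+ c)) (inv m)
  mean-multiples m c = mkMean 1ℚ bound
    where
    open ℚP.≤-Reasoning
    bound : ∀ x → 1 ℕ.≤ x → ∣ avg (λ n → 𝟙∣ m (n ℕ.+ c)) x - inv m ∣ ≤ 1ℚ * inv x
    bound x@(suc _) _ = begin
      ∣ sumTo (λ n → 𝟙∣ m (n ℕ.+ c)) x * inv x - inv m ∣
        ≡⟨ cong (λ s → ∣ s * inv x - inv m ∣) (sum-indicator m c x) ⟩
      ∣ C * inv x - inv m ∣
        ≡⟨ cong ∣_∣ (quotient-difference C m x) ⟩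
      ∣ (M * C - X) * (inv m * inv x) ∣
        ≡⟨ ℚP.∣p*q∣≡∣p∣*∣q∣ (M * C - X) (inv m * inv x) ⟩
      ∣ M * C - X ∣ * ∣ inv m * inv x ∣
        ≡⟨ cong (∣ M * C - X ∣ *_) (ℚP.0≤p⇒∣p∣≡p (0≤inv*inv m x)) ⟩
      ∣ M * C - X ∣ * (inv m * inv x)
        ≤⟨ ℚP.*-monoʳ-≤-nonNeg (inv m * inv x) {{ℚ.nonNegative (0≤inv*inv m x)}} close ⟩
      M * (inv m * inv x)
        ≡⟨ sym (ℚP.*-assoc M (inv m) (inv x)) ⟩
      M * inv m * inv x
        ≡⟨ cong (_* inv x) (inv-cancel m) ⟩
      1ℚ * inv x ∎
      where
      C = toℚ (+ count m c x)
      M = toℚ (+ m)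
      X = toℚ (+ x)
      close : ∣ M * C - X ∣ ≤ M
      close = subst (λ t → ∣ t - X ∣ ≤ M) (trans (cong toℚ (ℤP.pos-* m (count m c x))) (toℚ-* (+ m) (+ count m c x))) (count-close m c x)

module LocalFactors where

  open import Defs
  open import Data.Nat as ℕ using (ℕ; zero; suc; z≤n; s≤s; NonZero; NonTrivial; _^_; nonTrivial⇒nonZero; nonTrivial⇒≢1)
  import Data.Nat.Properties as ℕP
  open import Data.Integer as ℤ using (ℤ; +_)
  open import Data.Rational as ℚ using (ℚ; 0ℚ; 1ℚ; _+_; _*_; _-_)
  open import Data.Rational.Solver using (module +-*-Solver)
  open import Data.Nat.Divisibility using (_∣_; _∣?_; divides; ∣-trans; m∣m*n; *-cancelʳ-∣; *-monoˡ-∣; ∣m∣n⇒∣m+n; ∣m+n∣m⇒∣n)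
  open import Data.Sum using (_⊎_; inj₁; inj₂)
  import Data.Integer.Properties as ℤP
  open import Data.Empty using (⊥-elim)
  open import Relation.Nullary using (¬_; Dec; yes; no)
  open import Relation.Binary.PropositionalEquality
  open MeanValues

  p²∣⇒p∣ : ∀ {p n} → p ℕ.* p ∣ n → p ∣ n
  p²∣⇒p∣ {p} = ∣-trans (m∣m*n p)

  valFuel-zero : ∀ k p n → ¬ p ∣ n → valFuel k p n ≡ 0
  valFuel-zero zero    p n _ = refl
  valFuel-zero (suc k) p n p∤n with p ∣? n
  ... | yes p∣n = ⊥-elim (p∤n p∣n)
  ... | no _    = refl

  valuation-zero : ∀ p n → ¬ p ∣ n → valuation p n ≡ 0
  valuation-zero p n = valFuel-zero n p n

  valuation-one : ∀ p n → p ∣ n → ¬ p ℕ.* p ∣ n → valuation p n ≡ 1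
  valuation-one p zero    _   p²∤n = ⊥-elim (p²∤n (divides 0 refl))
  valuation-one p (suc k) p∣n p²∤n with p ∣? suc k
  ... | no p∤n = ⊥-elim (p∤n p∣n)
  ... | yes (divides m n≡mp) = cong suc (valFuel-zero k p m p∤m)
    where
    p∤m : ¬ p ∣ m
    p∤m p∣m = p²∤n (subst (p ℕ.* p ∣_) (sym n≡mp) (*-monoˡ-∣ p p∣m))

  valuation-deep : ∀ p n .{{_ : NonTrivial p}} → 1 ℕ.≤ n → p ℕ.* p ∣ n → 2 ℕ.≤ valuation p n
  valuation-deep p (suc k) _ p²∣n with p ∣? suc k
  ... | no p∤n = ⊥-elim (p∤n (p²∣⇒p∣ p²∣n))
  ... | yes (divides m n≡mp) = s≤s (positive k n≡mp)
    where
    instance _ = nonTrivial⇒nonZero p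
    p∣m : p ∣ m
    p∣m = *-cancelʳ-∣ p (subst (p ℕ.* p ∣_) n≡mp p²∣n)
    -- the remaining fuel k is nonzero, since m·p = 1 + k with p ≥ 2
    positive : ∀ k → suc k ≡ m ℕ.* p → 1 ℕ.≤ valFuel k p m
    positive zero    1≡mp = ⊥-elim (nonTrivial⇒≢1 (ℕP.m*n≡1⇒n≡1 m p (sym 1≡mp)))
    positive (suc k) _ with p ∣? m
    ... | yes _   = s≤s z≤n
    ... | no p∤m  = ⊥-elim (p∤m p∣m)

  -- The value of F_p at n when f vanishes on non-squarefree numbers:
  -- 1 if p ∤ n, e = F(p) if p ∥ n, and 0 if p² ∣ n.
  localFactor : ℤ → ℕ → ℕ → ℤ
  localFactor e p n with p ℕ.* p ∣? n | p ∣? n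
  ... | yes _ | _     = + 0
  ... | no _  | yes _ = e
  ... | no _  | no _  = + 1

  Fp≡localFactor : ∀ f χ p .{{_ : NonTrivial p}} → f 1 ≡ + 1 → χ 1 ≡ + 1 →
    (∀ k → 2 ℕ.≤ k → f (p ^ k) ≡ + 0) →
    ∀ n → 1 ℕ.≤ n → Fp f χ p n ≡ localFactor (Fpk f χ p 1) p n
  Fp≡localFactor f χ p f1 χ1 f-deep n n≥1 with p ℕ.* p ∣? n | p ∣? n
  ... | yes p²∣n | _ rewrite f-deep (valuation p n) (valuation-deep p n n≥1 p²∣n) = refl
  ... | no p²∤n | yes p∣n rewrite valuation-one p n p∣n p²∤n = refl
  ... | no _    | no p∤n rewrite valuation-zero p n p∤n | f1 | χ1 = refl

  localFactor-indicators : ∀ e p n →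
    toℚ (localFactor e p n) ≡ 1ℚ - (1ℚ - toℚ e) * 𝟙∣ p n - toℚ e * 𝟙∣ (p ℕ.* p) n
  localFactor-indicators e p n with p ℕ.* p ∣? n | p ∣? n
  ... | yes _    | yes _ =
    solve 1 (λ e → con 0ℚ := con 1ℚ :- (con 1ℚ :- e) :* con 1ℚ :- e :* con 1ℚ) refl (toℚ e)
    where open +-*-Solver
  ... | yes p²∣n | no p∤n = ⊥-elim (p∤n (p²∣⇒p∣ p²∣n))
  ... | no _     | yes _ =
    solve 1 (λ e → e := con 1ℚ :- (con 1ℚ :- e) :* con 1ℚ :- e :* con 0ℚ) refl (toℚ e)
    where open +-*-Solver
  ... | no _     | no _ =
    solve 1 (λ e → con 1ℚ := con 1ℚ :- (con 1ℚ :- e) :* con 0ℚ :- e :* con 0ℚ) refl (toℚ e)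
    where open +-*-Solver

  ∣-shift : ∀ {k d n} → k ∣ d → k ∣ n → k ∣ n ℕ.+ d
  ∣-shift k∣d k∣n = ∣m∣n⇒∣m+n k∣n k∣d

  ∣-unshift : ∀ {k d n} → k ∣ d → k ∣ n ℕ.+ d → k ∣ n
  ∣-unshift {k} {d} {n} k∣d k∣n+d = ∣m+n∣m⇒∣n (subst (k ∣_) (ℕP.+-comm n d) k∣n+d) k∣d

  ∤-shift : ∀ {k d n} → ¬ k ∣ d → k ∣ n → ¬ k ∣ n ℕ.+ d
  ∤-shift k∤d k∣n k∣n+d = k∤d (∣m+n∣m⇒∣n k∣n+d k∣n)

  laggedProduct : (ℕ → ℤ) → ℕ → ℕ → ℚ
  laggedProduct g d n = toℚ (g n ℤ.* g (n ℕ.+ d))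

  localFactor-unit : ∀ e p n → ¬ p ∣ n → localFactor e p n ≡ + 1
  localFactor-unit e p n p∤n with p ℕ.* p ∣? n | p ∣? n
  ... | yes p²∣n | _     = ⊥-elim (p∤n (p²∣⇒p∣ p²∣n))
  ... | no _     | yes p∣n = ⊥-elim (p∤n p∣n)
  ... | no _     | no _  = refl

  product-with-unit : ∀ a b → a ≡ + 1 ⊎ b ≡ + 1 → toℚ (a ℤ.* b) ≡ toℚ a + toℚ b - 1ℚ
  product-with-unit a b (inj₁ refl) rewrite ℤP.*-identityˡ b =
    solve 1 (λ b → b := con 1ℚ :+ b :- con 1ℚ) refl (toℚ b)
    where open +-*-Solver
  product-with-unit a b (inj₂ refl) rewrite ℤP.*-identityʳ a =
    solve 1 (λ a → a := a :+ con 1ℚ :- con 1ℚ) refl (toℚ a)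
    where open +-*-Solver

  -- Case p ∤ d: p divides at most one of n, n + d, so one local factor is 1.
  lagged-coprime : ∀ e p d n → ¬ p ∣ d →
    laggedProduct (localFactor e p) d n ≡ toℚ (localFactor e p n) + toℚ (localFactor e p (n ℕ.+ d)) - 1ℚ
  lagged-coprime e p d n p∤d = product-with-unit _ _ (one-factor-is-unit (p ∣? n))
    where
    one-factor-is-unit : Dec (p ∣ n) → localFactor e p n ≡ + 1 ⊎ localFactor e p (n ℕ.+ d) ≡ + 1
    one-factor-is-unit (yes p∣n) = inj₂ (localFactor-unit e p (n ℕ.+ d) (∤-shift p∤d p∣n))
    one-factor-is-unit (no p∤n)  = inj₁ (localFactor-unit e p n p∤n)

  -- Case p ∥ d (and e² = 1): p ∣ n iff p ∣ n + d, but p² divides at most one of them.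
  lagged-exact : ∀ e p d n → e ℤ.* e ≡ + 1 → p ∣ d → ¬ p ℕ.* p ∣ d →
    laggedProduct (localFactor e p) d n ≡ 1ℚ - 𝟙∣ (p ℕ.* p) n - 𝟙∣ (p ℕ.* p) (n ℕ.+ d)
  lagged-exact e p d n e²≡1 p∣d p²∤d
    with p ℕ.* p ∣? n | p ∣? n | p ℕ.* p ∣? (n ℕ.+ d) | p ∣? (n ℕ.+ d)
  ... | yes p²∣n | _       | yes p²∣n+d | _        = ⊥-elim (∤-shift p²∤d p²∣n p²∣n+d)
  ... | yes _    | _       | no _       | yes _    = refl
  ... | yes p²∣n | _       | no _       | no p∤n+d = ⊥-elim (p∤n+d (∣-shift p∣d (p²∣⇒p∣ p²∣n)))
  ... | no _     | yes _   | yes _      | _        rewrite ℤP.*-zeroʳ e = refl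
  ... | no _     | yes _   | no _       | yes _    rewrite e²≡1 = refl
  ... | no _     | yes p∣n | no _       | no p∤n+d = ⊥-elim (p∤n+d (∣-shift p∣d p∣n))
  ... | no _     | no p∤n  | yes p²∣n+d | _        = ⊥-elim (p∤n (∣-unshift p∣d (p²∣⇒p∣ p²∣n+d)))
  ... | no _     | no p∤n  | no _       | yes p∣n+d = ⊥-elim (p∤n (∣-unshift p∣d p∣n+d))
  ... | no _     | no _    | no _       | no _     = refl

  -- Case p² ∣ d (and e² = 1): n and n + d have the same local factor, whose square is 1 - [p² ∣ n].
  lagged-deep : ∀ e p d n → e ℤ.* e ≡ + 1 → p ℕ.* p ∣ d →
    laggedProduct (localFactor e p) d n ≡ 1ℚ - 𝟙∣ (p ℕ.* p) n
  lagged-deep e p d n e²≡1 p²∣d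
    with p ℕ.* p ∣? n | p ∣? n | p ℕ.* p ∣? (n ℕ.+ d) | p ∣? (n ℕ.+ d)
  ... | yes _    | _       | yes _      | _         = refl
  ... | yes p²∣n | _       | no p²∤n+d  | _         = ⊥-elim (p²∤n+d (∣-shift p²∣d p²∣n))
  ... | no p²∤n  | _       | yes p²∣n+d | _         = ⊥-elim (p²∤n (∣-unshift p²∣d p²∣n+d))
  ... | no _     | yes _   | no _       | yes _     rewrite e²≡1 = refl
  ... | no _     | yes p∣n | no _       | no p∤n+d  = ⊥-elim (p∤n+d (∣-shift (p²∣⇒p∣ p²∣d) p∣n))
  ... | no _     | no p∤n  | no _       | yes p∣n+d = ⊥-elim (p∤n (∣-unshift (p²∣⇒p∣ p²∣d) p∣n+d))
  ... | no _     | no _    | no _       | no _      = refl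

  mean-multiples₀ : ∀ m .{{_ : NonZero m}} → Mean (𝟙∣ m) (inv m)
  mean-multiples₀ m = mean-ext (λ n _ → cong (𝟙∣ m) (ℕP.+-identityʳ n)) (mean-multiples m 0)

  mean-localFactor : ∀ e p c .{{_ : NonZero p}} →
    Mean (λ n → toℚ (localFactor e p (n ℕ.+ c))) (1ℚ - (1ℚ - toℚ e) * inv p - toℚ e * inv (p ℕ.* p))
  mean-localFactor e p c =
    mean-ext (λ n _ → sym (localFactor-indicators e p (n ℕ.+ c)))
      (mean-- (mean-- mean-one (mean-scale (1ℚ - toℚ e) (mean-multiples p c)))
              (mean-scale (toℚ e) (mean-multiples (p ℕ.* p) c)))
    where instance _ = ℕP.m*n≢0 p p

  -- The three mean values of the lagged product of the local factor.
  -- p ∤ d: twice the mean of the local factor, minus 1, which is h(p).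
  mean-lagged-coprime : ∀ e p d .{{_ : NonZero p}} → ¬ p ∣ d →
    Mean (laggedProduct (localFactor e p) d)
         ((1ℚ - toℚ (+ 2) * (1ℚ - toℚ e) * inv p) - toℚ (+ 2) * toℚ e * inv (p ℕ.* p))
  mean-lagged-coprime e p d p∤d =
    subst (Mean _) limit
      (mean-ext (λ n _ → sym (trans (lagged-coprime e p d n p∤d)
                                    (cong (λ m → toℚ (localFactor e p m) + toℚ (localFactor e p (n ℕ.+ d)) - 1ℚ)
                                          (sym (ℕP.+-identityʳ n)))))
        (mean-- (mean-+ (mean-localFactor e p 0) (mean-localFactor e p d)) mean-one))
    where
    open +-*-Solver
    limit : (1ℚ - (1ℚ - toℚ e) * inv p - toℚ e * inv (p ℕ.* p)) + (1ℚ - (1ℚ - toℚ e) * inv p - toℚ e * inv (p ℕ.* p)) - 1ℚ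
          ≡ (1ℚ - toℚ (+ 2) * (1ℚ - toℚ e) * inv p) - toℚ (+ 2) * toℚ e * inv (p ℕ.* p)
    limit = solve 3 (λ e i j → (con 1ℚ :- (con 1ℚ :- e) :* i :- e :* j) :+ (con 1ℚ :- (con 1ℚ :- e) :* i :- e :* j) :- con 1ℚ
                            := (con 1ℚ :- con (toℚ (+ 2)) :* (con 1ℚ :- e) :* i) :- con (toℚ (+ 2)) :* e :* j)
                    refl (toℚ e) (inv p) (inv (p ℕ.* p))

  mean-lagged-exact : ∀ e p d .{{_ : NonZero p}} → e ℤ.* e ≡ + 1 → p ∣ d → ¬ p ℕ.* p ∣ d →
    Mean (laggedProduct (localFactor e p) d) (1ℚ - toℚ (+ 2) * inv (p ℕ.* p))
  mean-lagged-exact e p d e²≡1 p∣d p²∤d =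
    subst (Mean _) limit
      (mean-ext (λ n _ → sym (lagged-exact e p d n e²≡1 p∣d p²∤d))
        (mean-- (mean-- mean-one (mean-multiples₀ (p ℕ.* p))) (mean-multiples (p ℕ.* p) d)))
    where
    instance _ = ℕP.m*n≢0 p p
    open +-*-Solver
    limit : 1ℚ - inv (p ℕ.* p) - inv (p ℕ.* p) ≡ 1ℚ - toℚ (+ 2) * inv (p ℕ.* p)
    limit = solve 1 (λ j → con 1ℚ :- j :- j := con 1ℚ :- con (toℚ (+ 2)) :* j) refl (inv (p ℕ.* p))

  mean-lagged-deep : ∀ e p d .{{_ : NonZero p}} → e ℤ.* e ≡ + 1 → p ℕ.* p ∣ d →
    Mean (laggedProduct (localFactor e p) d) (1ℚ - inv (p ℕ.* p))
  mean-lagged-deep e p d e²≡1 p²∣d =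
    mean-ext (λ n _ → sym (lagged-deep e p d n e²≡1 p²∣d)) (mean-- mean-one (mean-multiples₀ (p ℕ.* p)))
    where instance _ = ℕP.m*n≢0 p p

open import Defs
open import Data.Nat as ℕ using (ℕ; zero; suc; z≤n; s≤s; NonZero; _^_; _≤_; _*_; _+_)
import Data.Nat.Properties as ℕP
open import Data.Nat.DivMod using (_%_; _/_; m%n<n; m≡m%n+[m/n]*n)
open import Data.Nat.Divisibility using (_∣_; divides; ∣-trans)
open import Data.Nat.Coprimality using (Coprime)
open import Data.Nat.Primality using (Prime; prime⇒irreducible; prime⇒nonZero; prime⇒nonTrivial)
open import Data.Integer as ℤ using (ℤ; +_; -_; -[1+_])
import Data.Integer.Properties as ℤP
open import Data.Rational using (_-_; 1ℚ)
import Data.Rational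
open import Data.Product using (_×_; ∃; _,_)
open import Data.Sum using (_⊎_; inj₁; inj₂)
open import Data.Empty using (⊥-elim)
open import Relation.Nullary using (¬_)
open import Relation.Binary.PropositionalEquality
open import Function using (_∘_)
open MeanValues using (Mean; mean-ext; mean⇒converges)
open LocalFactors using (localFactor; Fp≡localFactor; laggedProduct; mean-lagged-coprime; mean-lagged-exact; mean-lagged-deep)

-- A periodic integer-valued function is bounded (by the sum of |g| over one period).
periodic-bounded : ∀ (g : ℕ → ℤ) q .{{_ : NonZero q}} → (∀ n → g (n + q) ≡ g n) →
  ∃ λ B → ∀ n → ℤ.∣ g n ∣ ≤ B
periodic-bounded g q periodic = periodSum q , λ n → subst (λ t → ℤ.∣ t ∣ ≤ periodSum q) (sym (reduce n))
  (below-sum (n % q) q (m%n<n n q))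
  where
  periodSum : ℕ → ℕ
  periodSum zero    = 0
  periodSum (suc k) = periodSum k + ℤ.∣ g k ∣
  below-sum : ∀ r k → r ℕ.< k → ℤ.∣ g r ∣ ≤ periodSum k
  below-sum r (suc k) (s≤s r≤k) with ℕP.m≤n⇒m<n∨m≡n r≤k
  ... | inj₁ r<k  = ℕP.≤-trans (below-sum r k r<k) (ℕP.m≤m+n (periodSum k) _)
  ... | inj₂ refl = ℕP.m≤n+m _ (periodSum k)
  periods : ∀ r k → g (r + k * q) ≡ g r
  periods r zero    = cong g (ℕP.+-identityʳ r)
  periods r (suc k) = begin
    g (r + (q + k * q)) ≡⟨ cong g (trans (cong (λ t → r + t) (ℕP.+-comm q (k * q))) (sym (ℕP.+-assoc r (k * q) q))) ⟩
    g (r + k * q + q)   ≡⟨ periodic (r + k * q) ⟩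
    g (r + k * q)       ≡⟨ periods r k ⟩
    g r                 ∎
    where open ≡-Reasoning
  reduce : ∀ n → g n ≡ g (n % q)
  reduce n = trans (cong g (m≡m%n+[m/n]*n n q)) (periods (n % q) (n / q))

k<2^k : ∀ k → k ℕ.< 2 ^ k
k<2^k zero    = s≤s z≤n
k<2^k (suc k) = ℕP.≤-<-trans (k<2^k k) (ℕP.m<m+n (2 ^ k) (ℕP.<-≤-trans (ℕP.m^n>0 2 k) (ℕP.m≤m+n (2 ^ k) 0)))

-- A bounded, completely multiplicative integer-valued function takes only
-- the values 0 and ±1: if |g(n)| ≥ 2 then |g(n^B)| ≥ 2^B > B.
bounded-unit : ∀ (g : ℕ → ℤ) → g 1 ≡ + 1 → (∀ m n → g (m * n) ≡ g m ℤ.* g n) →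
  ∀ B → (∀ n → ℤ.∣ g n ∣ ≤ B) → ∀ n → g n ≢ + 0 → ℤ.∣ g n ∣ ≡ 1
bounded-unit g g1 mult B bound n gn≢0 with ℤ.∣ g n ∣ in ∣gn∣≡
... | zero        = ⊥-elim (gn≢0 (ℤP.∣i∣≡0⇒i≡0 ∣gn∣≡))
... | suc zero    = refl
... | suc (suc a) = ⊥-elim (ℕP.<-irrefl refl (begin-strict
  B                     <⟨ k<2^k B ⟩
  2 ^ B                 ≤⟨ ℕP.^-monoˡ-≤ B (s≤s (s≤s z≤n)) ⟩
  suc (suc a) ^ B       ≡⟨ cong (_^ B) (sym ∣gn∣≡) ⟩
  ℤ.∣ g n ∣ ^ B         ≡⟨ sym (power B) ⟩
  ℤ.∣ g (n ^ B) ∣       ≤⟨ bound (n ^ B) ⟩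
  B                     ∎))
  where
  open ℕP.≤-Reasoning
  power : ∀ k → ℤ.∣ g (n ^ k) ∣ ≡ ℤ.∣ g n ∣ ^ k
  power zero    = cong ℤ.∣_∣ g1
  power (suc k) = trans (cong ℤ.∣_∣ (mult n (n ^ k)))
                  (trans (ℤP.∣i*j∣≡∣i∣*∣j∣ (g n) (g (n ^ k))) (cong (λ t → ℤ.∣ g n ∣ * t) (power k)))

prime-coprime : ∀ {p q} → Prime p → ¬ p ∣ q → Coprime p q
prime-coprime pr p∤q (d∣p , d∣q) with prime⇒irreducible pr d∣p
... | inj₁ d≡1 = d≡1
... | inj₂ refl = ⊥-elim (p∤q d∣q)

character-at-prime : ∀ {q χ p} → IsDirichletChar q χ → Prime p → ¬ p ∣ q → ℤ.∣ χ p ∣ ≡ 1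
character-at-prime {q} {χ} {p} (q≥1 , χ1 , χ-mult , χ-periodic , χ-coprime , _) p-prime p∤q
  with periodic-bounded χ q {{ℕ.>-nonZero q≥1}} χ-periodic
... | B , bound = bounded-unit χ χ1 χ-mult B bound p (χ-coprime p (prime-coprime p-prime p∤q))

∣±1∣≡1 : ∀ {z} → z ≡ + 1 ⊎ z ≡ - + 1 → ℤ.∣ z ∣ ≡ 1
∣±1∣≡1 (inj₁ refl) = refl
∣±1∣≡1 (inj₂ refl) = refl

unit-product-square : ∀ a b → ℤ.∣ a ∣ ≡ 1 → ℤ.∣ b ∣ ≡ 1 → (a ℤ.* b) ℤ.* (a ℤ.* b) ≡ + 1
unit-product-square a b ∣a∣≡1 ∣b∣≡1 =
  square (a ℤ.* b) (trans (ℤP.∣i*j∣≡∣i∣*∣j∣ a b) (cong₂ _*_ ∣a∣≡1 ∣b∣≡1))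
  where
  square : ∀ z → ℤ.∣ z ∣ ≡ 1 → z ℤ.* z ≡ + 1
  square (+ 1)     _ = refl
  square -[1+ 0 ]  _ = refl

square∣power : ∀ p k → 2 ≤ k → p * p ∣ p ^ k
square∣power p (suc zero)    (s≤s ())
square∣power p (suc (suc k)) _ =
  divides (p ^ k) (trans (sym (ℕP.*-assoc p p (p ^ k))) (ℕP.*-comm (p * p) (p ^ k)))

lemma2p5 : (f χ : ℕ → ℤ) (q : ℕ) →
    Multiplicative f →
    (∀ n → 1 ≤ n → f n ≡ + 1 ⊎ f n ≡ + 0 ⊎ f n ≡ - + 1) →
    (∀ n → 1 ≤ n → ¬ SquareFree n → f n ≡ + 0) →
    (∀ p → Prime p → f p ≡ + 1 ⊎ f p ≡ - + 1) →
    IsDirichletChar q χ → NonPrincipal q χ → Primitive q χ →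
    PretFinite f χ →
    (p : ℕ) → Prime p → ¬ (p ∣ q) →
    (d n : ℕ) → 1 ≤ d → p ^ n ∣ d → ¬ (p ^ (n + 1) ∣ d) →
    (n ≡ 0 → ConvergesTo (Mavg f χ p d) (hval f χ p)) ×
    (n ≡ 1 → ConvergesTo (Mavg f χ p d) (1ℚ - (toℚ (+ 2) Data.Rational.* inv (p * p)))) ×
    (2 ≤ n → ConvergesTo (Mavg f χ p d) (1ℚ - inv (p * p)))
lemma2p5 f χ q (f1 , _) _ f-nonSquarefree f-prime χ-char@(_ , χ1 , _) _ _ _ p p-prime p∤q d n _ pⁿ∣d pⁿ⁺¹∤d =
    (λ n≡0 → converge (mean-lagged-coprime e p d (p∤d n≡0)))
  , (λ n≡1 → converge (mean-lagged-exact e p d e²≡1 (p∣d n≡1) (p²∤d n≡1)))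
  , (λ n≥2 → converge (mean-lagged-deep e p d e²≡1 (∣-trans (square∣power p n n≥2) pⁿ∣d)))
  where
  instance
    _ = prime⇒nonTrivial p-prime
    _ = prime⇒nonZero p-prime
  e = Fpk f χ p 1
  p¹≡p = ℕP.*-identityʳ p

  -- F(p) = f(p) χ(p) with f(p) = ±1 and χ(p) = ±1.
  e²≡1 : e ℤ.* e ≡ + 1
  e²≡1 = subst (λ m → (f m ℤ.* χ m) ℤ.* (f m ℤ.* χ m) ≡ + 1) (sym p¹≡p)
    (unit-product-square (f p) (χ p) (∣±1∣≡1 (f-prime p p-prime)) (character-at-prime χ-char p-prime p∤q))

  -- f vanishes on p^k, k ≥ 2, so F_p is the local factor with e = F(p).
  Fp-local : ∀ m → 1 ≤ m → Fp f χ p m ≡ localFactor e p m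
  Fp-local = Fp≡localFactor f χ p f1 χ1
    (λ k k≥2 → f-nonSquarefree (p ^ k) (ℕP.m^n>0 p k) (λ sf → sf p p-prime (square∣power p k k≥2)))

  converge : ∀ {L} → Mean (laggedProduct (localFactor e p) d) L → ConvergesTo (Mavg f χ p d) L
  converge = mean⇒converges ∘ mean-ext λ m m≥1 →
    cong toℚ (sym (cong₂ ℤ._*_ (Fp-local m m≥1) (Fp-local (m + d) (ℕP.≤-trans m≥1 (ℕP.m≤m+n m d)))))

  p∤d : n ≡ 0 → ¬ p ∣ d
  p∤d refl p∣d = pⁿ⁺¹∤d (subst (_∣ d) (sym p¹≡p) p∣d)
  p∣d : n ≡ 1 → p ∣ d
  p∣d refl = subst (_∣ d) p¹≡p pⁿ∣d
  p²∤d : n ≡ 1 → ¬ p * p ∣ d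
  p²∤d refl p²∣d = pⁿ⁺¹∤d (subst (λ m → p * m ∣ d) (sym p¹≡p) p²∣d)
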